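{- For every semistandard tableau $T$ with entries in $[n]$, \[ \mathsf{P}(\mathsf{D}(T))/\mathrm{pha}_T(Y)=\Phi_T(Y). \]
   Context: Tableaux: a semistandard tableau with entries in $[n]$ is a left-justified Young diagram filled with elements of $[n]$, weakly increasing along rows, strictly increasing down columns; $T_{ij}$ is the entry in row $i$, column $j$; $T=(C_1,\dots,C_\ell)$ lists column entry sets. $\mathrm{Leg}^+_T(i,j)=C_j\cap\{T_{ij},\dots,T_{i(j+1)}\}$ if the $(i,j+1)$-cell exists and $T_{i(j+1)}\notin C_j$, else $\varnothing$; $\Phi_T(Y)=\prod_{(i,j):\mathrm{Leg}^+_T(i,j)\neq\varnothing}(1-Y^{\#\mathrm{Leg}^+_T(i,j)})$. Dyck words: words in letters $\mathbf0,\mathbf1$ with equally many of each and no initial segment containing more $\mathbf1$s than $\mathbf0$s. For a two-column tableau $(C_1,C_2)$, let $\bar C_1=C_1\setminus C_2$ ($\#\bar C_1=a$), $\bar C_2=C_2\setminus C_1$ ($\#\bar C_2=b\le a$); list the elements of $\bar C_1\cup\bar C_2$ in increasing order, replace elements of $\bar C_1$ by $\mathbf0$ and of $\bar C_2$ by $\mathbf1$, and append $a-b$ further copies of $\mathbf1$; this Dyck word is $\mathsf{D}((C_1,C_2))$. For $T=(C_1,\dots,C_\ell)$, $\mathsf{D}(T)$ is the concatenation $\mathsf{D}((C_1,C_2))\mathsf{D}((C_2,C_3))\cdots\mathsf{D}((C_{\ell-1},C_\ell))$ (empty if $\ell\le1$). For a Dyck word $w=\mathbf0^{\ell_1}\mathbf1^{m_1}\cdots\mathbf0^{\ell_r}\mathbf1^{m_r}$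 ($r\ge0$, all $\ell_i,m_i\ge1$), set $b_k=\sum_{i\le k}(\ell_i-m_i)$ and $t_k=m_k+b_k$; with $[\![0]\!]=1$, $[\![m]\!]=1-Y^m$, $[\![m]\!]!=\prod_{j=1}^m[\![j]\!]$, define $\mathsf{P}(w)=\prod_{k=1}^r[\![t_k]\!]!/[\![b_k]\!]!$. The phantom factor is $\mathrm{pha}_T(Y)=\prod_{s=1}^{\ell-1}[\![\#C_s-\#C_{s+1}]\!]!$. -}

module Defs where

open import Level using (Level)
open import Data.Bool using (Bool; true; false; if_then_else_)
open import Data.Nat using (ℕ; zero; suc; _+_; _∸_; _≤_; _<?_; _≤?_; _≟_)
open import Data.Product using (_×_; _,_)
open import Data.Unit using (⊤)
open import Data.Empty using (⊥)
open import Data.List using (List; []; _∷_; length; filter; map; replicate; _++_; foldr)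
open import Data.List.Relation.Unary.All using (All)
open import Data.List.Relation.Unary.Linked using (Linked)
open import Data.List.Relation.Unary.Any using (any?)
open import Relation.Nullary using (¬_; yes; no)
open import Relation.Nullary.Decidable using (_×-dec_; ¬?)
open import Algebra.Bundles using (CommutativeRing)

-- Semistandard tableaux, given as the list of their columns
-- T = (C₁,…,C_ℓ); each column is listed top to bottom, so T_ij is the
-- i-th entry of C_j.

RowWeak : List ℕ → List ℕ → Set
RowWeak _ [] = ⊤
RowWeak [] (_ ∷ _) = ⊥
RowWeak (x ∷ xs) (y ∷ ys) = (x ≤ y) × RowWeak xs ys

NonEmpty : List ℕ → Set
NonEmpty [] = ⊥
NonEmpty (_ ∷ _) = ⊤

record SSYT (n : ℕ) : Set where
  field
    cols        : List (List ℕ)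
    colNonEmpty : All NonEmpty cols
    colStrict   : All (Linked Data.Nat._<_) cols
    entries     : All (All (λ x → (1 ≤ x) × (x ≤ n))) cols
    shape       : Linked (λ C D → length D ≤ length C) cols
    rowWeak     : Linked RowWeak cols
open SSYT public

_∈ᵇ_ : ℕ → List ℕ → Bool
x ∈ᵇ C = Relation.Nullary.Decidable.⌊ any? (x ≟_) C ⌋

minus : List ℕ → List ℕ → List ℕ
minus C D = filter (λ x → ¬? (any? (x ≟_) D)) C

data Letter : Set where
  𝟎 𝟏 : Letter

mergeLab : List ℕ → List ℕ → List Letter
mergeLab [] ys = map (λ _ → 𝟏) ys
mergeLab (x ∷ xs) [] = 𝟎 ∷ mergeLab xs []
mergeLab (x ∷ xs) (y ∷ ys) =
  if x Data.Nat.<ᵇ y then 𝟎 ∷ mergeLab xs (y ∷ ys)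
  else 𝟏 ∷ mergeLab (x ∷ xs) ys

D₂ : List ℕ → List ℕ → List Letter
D₂ C₁ C₂ = mergeLab C̄₁ C̄₂ ++ replicate (length C̄₁ ∸ length C̄₂) 𝟏
  where
  C̄₁ = minus C₁ C₂
  C̄₂ = minus C₂ C₁

Dcols : List (List ℕ) → List Letter
Dcols [] = []
Dcols (C ∷ []) = []
Dcols (C ∷ C' ∷ Cs) = D₂ C C' ++ Dcols (C' ∷ Cs)

D : ∀ {n} → SSYT n → List Letter
D T = Dcols (cols T)

-- decomposition w = 𝟎^{ℓ₁}𝟏^{m₁}⋯𝟎^{ℓ_r}𝟏^{m_r} into the list of
-- pairs (ℓ_k , m_k)  (computed right to left)
runs : List Letter → List (ℕ × ℕ)
runs [] = []
runs (𝟎 ∷ w) with runs w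
... | [] = (1 , 0) ∷ []
... | (l , m) ∷ rs = (suc l , m) ∷ rs
runs (𝟏 ∷ w) with runs w
... | [] = (0 , 1) ∷ []
... | (zero , m) ∷ rs = (0 , suc m) ∷ rs
... | (suc l , m) ∷ rs = (0 , 1) ∷ (suc l , m) ∷ rs

-- Polynomial expressions in Y, evaluated in an arbitrary commutative
-- ring R at an arbitrary element Y (universal for identities in ℤ[Y]).

module _ {c ℓ : Level} (R : CommutativeRing c ℓ) where
  open CommutativeRing R using (Carrier; 1#; _-_; _*_)

  pow : Carrier → ℕ → Carrier
  pow Y zero = 1#
  pow Y (suc m) = Y * pow Y m

  qint : Carrier → ℕ → Carrier
  qint Y zero = 1#
  qint Y (suc m) = 1# - pow Y (suc m)

  qfact : Carrier → ℕ → Carrier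
  qfact Y zero = 1#
  qfact Y (suc m) = qfact Y m * qint Y (suc m)

  -- [[b+d]]! / [[b]]! = ∏_{j=1}^{d} [[b+j]]   (exact quotient)
  qratioD : Carrier → ℕ → ℕ → Carrier
  qratioD Y b zero = 1#
  qratioD Y b (suc d) = qratioD Y b d * qint Y (b + suc d)

  -- [[t]]!/[[b]]! for b ≤ t
  qratio : Carrier → ℕ → ℕ → Carrier
  qratio Y t b = qratioD Y b (t ∸ b)

  Pruns : Carrier → ℕ → List (ℕ × ℕ) → Carrier
  Pruns Y bprev [] = 1#
  Pruns Y bprev ((l , m) ∷ rs) = qratio Y t b * Pruns Y b rs
    where
    b = (bprev + l) ∸ m
    t = m + b

  P : Carrier → List Letter → Carrier
  P Y w = Pruns Y 0 (runs w)

  phaCols : Carrier → List (List ℕ) → Carrier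
  phaCols Y [] = 1#
  phaCols Y (C ∷ []) = 1#
  phaCols Y (C ∷ C' ∷ Cs) = qfact Y (length C ∸ length C') * phaCols Y (C' ∷ Cs)

  pha : ∀ {n} → Carrier → SSYT n → Carrier
  pha Y T = phaCols Y (cols T)

  -- Leg⁺_T(i,j) for the cells of column C_j = C (with the next column
  -- C_{j+1} = rows D, if present).  Row entries: c = T_ij, d = T_{i(j+1)}.
  -- legsCol C rowsOfC rowsOfD returns the list of Leg⁺ sets of the cells of C.
  legsCol : List ℕ → List ℕ → List ℕ → List (List ℕ)
  legsCol C [] _ = []
  legsCol C (c ∷ cs) [] = [] ∷ legsCol C cs []
  legsCol C (c ∷ cs) (d ∷ ds) =
    (if d ∈ᵇ C then []
     else filter (λ x → (c ≤? x) ×-dec (x ≤? d)) C)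
    ∷ legsCol C cs ds

  legsCols : List (List ℕ) → List (List ℕ)
  legsCols [] = []
  legsCols (C ∷ []) = legsCol C C []
  legsCols (C ∷ C' ∷ Cs) = legsCol C C C' ++ legsCols (C' ∷ Cs)

  legFactor : Carrier → List ℕ → Carrier
  legFactor Y [] = 1#
  legFactor Y L@(_ ∷ _) = 1# - pow Y (length L)

  Φ : ∀ {n} → Carrier → SSYT n → Carrier
  Φ Y T = foldr (λ L acc → legFactor Y L * acc) 1# (legsCols (cols T))

-- Read a word as a lattice path (𝟎 up, 𝟏 down) and weight each down-step by [[h]], where h is
-- the height before the step. A run 𝟎^ℓ 𝟏^m entered at height b contributes
-- [[b+ℓ]]⋯[[b+ℓ−m+1]] = [[t]]!/[[b']]!, so P(w) is the weight of the ballot path w. The weight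
-- is multiplicative along D(T) = D(C₁,C₂)⋯D(C_{ℓ−1},C_ℓ), each factor being a Dyck path. In
-- D(C,C') the down-step of d ∈ C'∖C is taken at height #{x ∈ C : x < d} − #{y ∈ C' : y < d}
-- (common entries cancel), and if d = T_{i,j+1} and c = T_{ij} this is #(C ∩ [c,d]) = #Leg⁺_T(i,j).
-- The closing 𝟏^{a−b}, taken from height a − b = #C − #C', contributes the phantom factor.

module Submission where

open import Algebra.Bundles using (CommutativeRing)
open import Data.Bool using (Bool; true; false; if_then_else_; T)
open import Data.Empty using (⊥; ⊥-elim)
open import Data.List using (List; []; _∷_; [_]; length; filter; replicate; _++_; foldr)
open import Data.List.Properties
  using (++-assoc; length-++; filter-++; filter-accept; filter-reject; filter-all; filter-none)
open import Data.List.Relation.Unary.All using (All; []; _∷_)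
import Data.List.Relation.Unary.All as All
open import Data.List.Relation.Unary.All.Properties using (All¬⇒¬Any; ¬Any⇒All¬; ++⁺)
open import Data.List.Relation.Unary.AllPairs using (AllPairs; []; _∷_)
import Data.List.Relation.Unary.AllPairs.Properties as AllPairsₚ
open import Data.List.Relation.Unary.Any using (Any; here; there; any?)
open import Data.List.Relation.Unary.Any.Properties using (++⁺ʳ)
open import Data.List.Relation.Unary.Linked using (Linked; _∷_)
open import Data.List.Relation.Unary.Linked.Properties using (Linked⇒AllPairs)
open import Data.Nat
  using (ℕ; zero; suc; pred; _+_; _∸_; _≤_; _<_; z≤n; s≤s; z<s; s≤s⁻¹; _<ᵇ_; _<?_; _≤?_; _≟_)
open import Data.Nat.Properties
  using (+-suc; +-identityʳ; +-assoc; +-comm; +-commutativeSemigroup; +-cancelʳ-<; +-monoʳ-<;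
         ≤-refl; ≤-trans; <-trans; <-irrefl; <-≤-trans; <-cmp; <⇒≤; <⇒≢; <⇒≱; ≤⇒≯; ≮⇒≥; ≤∧≢⇒<;
         <⇒<ᵇ; <ᵇ⇒<; m<m+n; m+n∸m≡n; m+n∸n≡m; m∸n+n≡m; [m+n]∸[m+o]≡n∸o)
open import Data.Product using (_×_; _,_; proj₁; proj₂)
open import Data.Unit using (⊤; tt)
open import Function using (_$_)
open import Relation.Binary.Definitions using (Tri; tri<; tri≈; tri>)
open import Relation.Binary.PropositionalEquality
  using (_≡_; _≢_; refl; sym; trans; cong; cong₂; subst; subst₂; ≢-sym; module ≡-Reasoning)
open import Relation.Nullary using (¬_; Dec; yes; no)
open import Relation.Nullary.Decidable using (¬?; _×-dec_; dec-true; dec-false; isYes≗does)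
open import Relation.Unary using (Pred; Decidable)
open import Relation.Unary.Properties using (U?)

open import Algebra.Properties.CommutativeSemigroup +-commutativeSemigroup using (x∙yz≈y∙xz)

open import Defs

height : ℕ → List Letter → ℕ
height h [] = h
height h (𝟎 ∷ w) = height (suc h) w
height h (𝟏 ∷ w) = height (pred h) w

Ballot : ℕ → List Letter → Set
Ballot h [] = ⊤
Ballot h (𝟎 ∷ w) = Ballot (suc h) w
Ballot zero (𝟏 ∷ w) = ⊥
Ballot (suc h) (𝟏 ∷ w) = Ballot h w

Dyck : List Letter → Set
Dyck w = Ballot 0 w × height 0 w ≡ 0

#𝟎 #𝟏 : List Letter → ℕ
#𝟎 [] = 0
#𝟎 (𝟎 ∷ w) = suc (#𝟎 w)
#𝟎 (𝟏 ∷ w) = #𝟎 w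
#𝟏 [] = 0
#𝟏 (𝟎 ∷ w) = #𝟏 w
#𝟏 (𝟏 ∷ w) = suc (#𝟏 w)

height-++ : ∀ h u v → height h (u ++ v) ≡ height (height h u) v
height-++ h [] v = refl
height-++ h (𝟎 ∷ u) v = height-++ (suc h) u v
height-++ h (𝟏 ∷ u) v = height-++ (pred h) u v

ballot-++ : ∀ h u v → Ballot h u → Ballot (height h u) v → Ballot h (u ++ v)
ballot-++ h [] v _ bv = bv
ballot-++ h (𝟎 ∷ u) v bu bv = ballot-++ (suc h) u v bu bv
ballot-++ (suc h) (𝟏 ∷ u) v bu bv = ballot-++ h u v bu bv

dyck-++ : ∀ u v → Dyck u → Dyck v → Dyck (u ++ v)
dyck-++ u v (bu , hu) (bv , hv) =
  ballot-++ 0 u v bu (subst (λ h → Ballot h v) (sym hu) bv) ,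
  trans (height-++ 0 u v) (trans (cong (λ h → height h v) hu) hv)

ballot-height : ∀ h w → Ballot h w → height h w + #𝟏 w ≡ h + #𝟎 w
ballot-height h [] _ = refl
ballot-height h (𝟎 ∷ w) b = trans (ballot-height (suc h) w b) (sym (+-suc h (#𝟎 w)))
ballot-height (suc h) (𝟏 ∷ w) b = trans (+-suc (height h w) (#𝟏 w)) (cong suc (ballot-height h w b))

ballot-𝟏^ : ∀ k → Ballot k (replicate k 𝟏)
ballot-𝟏^ zero = tt
ballot-𝟏^ (suc k) = ballot-𝟏^ k

height-𝟏^ : ∀ k → height k (replicate k 𝟏) ≡ 0
height-𝟏^ zero = refl
height-𝟏^ (suc k) = height-𝟏^ k

dyck-𝟏^ : ∀ w k → Ballot 0 w → height 0 w ≡ k → Dyck (w ++ replicate k 𝟏)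
dyck-𝟏^ w k ballot height≡k =
  ballot-++ 0 w _ ballot (subst (λ h → Ballot h (replicate k 𝟏)) (sym height≡k) (ballot-𝟏^ k)) ,
  trans (height-++ 0 w _) (trans (cong (λ h → height h (replicate k 𝟏)) height≡k) (height-𝟏^ k))

unruns : List (ℕ × ℕ) → List Letter
unruns [] = []
unruns ((l , m) ∷ rs) = replicate l 𝟎 ++ replicate m 𝟏 ++ unruns rs

unruns-runs : ∀ w → unruns (runs w) ≡ w
unruns-runs [] = refl
unruns-runs (𝟎 ∷ w) with runs w | unruns-runs w
... | [] | eq = cong (𝟎 ∷_) eq
... | _ ∷ _ | eq = cong (𝟎 ∷_) eq
unruns-runs (𝟏 ∷ w) with runs w | unruns-runs w
... | [] | eq = cong (𝟏 ∷_) eq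
... | (zero , m) ∷ rs | eq = cong (𝟏 ∷_) eq
... | (suc l , m) ∷ rs | eq = cong (𝟏 ∷_) eq

ballot-𝟎^ : ∀ l h w → Ballot h (replicate l 𝟎 ++ w) → Ballot (h + l) w
ballot-𝟎^ zero h w b = subst (λ z → Ballot z w) (sym (+-identityʳ h)) b
ballot-𝟎^ (suc l) h w b = subst (λ z → Ballot z w) (sym (+-suc h l)) (ballot-𝟎^ l (suc h) w b)

ballot-𝟏^⇒≤ : ∀ m h w → Ballot h (replicate m 𝟏 ++ w) → m ≤ h
ballot-𝟏^⇒≤ zero h w _ = z≤n
ballot-𝟏^⇒≤ (suc m) (suc h) w b = s≤s (ballot-𝟏^⇒≤ m h w b)

ballot-𝟏^-++ : ∀ m b w → Ballot (b + m) (replicate m 𝟏 ++ w) → Ballot b w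
ballot-𝟏^-++ zero b w v = subst (λ z → Ballot z w) (+-identityʳ b) v
ballot-𝟏^-++ (suc m) b w v rewrite +-suc b m = ballot-𝟏^-++ m b w v

if-elim : ∀ {a p} {A : Set a} (P : A → Set p) b {u v : A} → P u → P v → P (if b then u else v)
if-elim P true pu pv = pu
if-elim P false pu pv = pv

#𝟎-mergeLab : ∀ A B → #𝟎 (mergeLab A B) ≡ length A
#𝟎-mergeLab [] [] = refl
#𝟎-mergeLab [] (y ∷ B) = #𝟎-mergeLab [] B
#𝟎-mergeLab (x ∷ A) [] = cong suc (#𝟎-mergeLab A [])
#𝟎-mergeLab (x ∷ A) (y ∷ B) = if-elim (λ w → #𝟎 w ≡ suc (length A)) (x <ᵇ y)
  (cong suc (#𝟎-mergeLab A (y ∷ B))) (#𝟎-mergeLab (x ∷ A) B)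

#𝟏-mergeLab : ∀ A B → #𝟏 (mergeLab A B) ≡ length B
#𝟏-mergeLab [] [] = refl
#𝟏-mergeLab [] (y ∷ B) = cong suc (#𝟏-mergeLab [] B)
#𝟏-mergeLab (x ∷ A) [] = #𝟏-mergeLab A []
#𝟏-mergeLab (x ∷ A) (y ∷ B) = if-elim (λ w → #𝟏 w ≡ suc (length B)) (x <ᵇ y)
  (#𝟏-mergeLab A (y ∷ B)) (cong suc (#𝟏-mergeLab (x ∷ A) B))

mergeLab-𝟎 : ∀ {x} A {B} → All (x <_) B → mergeLab (x ∷ A) B ≡ 𝟎 ∷ mergeLab A B
mergeLab-𝟎 A [] = refl
mergeLab-𝟎 {x} A {y ∷ B} (x<y ∷ _) with x <ᵇ y | <⇒<ᵇ x<y
... | true | _ = refl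

mergeLab-𝟏 : ∀ {y} A {B} → All (y ≤_) A → mergeLab A (y ∷ B) ≡ 𝟏 ∷ mergeLab A B
mergeLab-𝟏 [] _ = refl
mergeLab-𝟏 {y} (a ∷ A) (y≤a ∷ _) with a <ᵇ y in a<ᵇy
... | false = refl
... | true = ⊥-elim (≤⇒≯ y≤a (<ᵇ⇒< a y (subst T (sym a<ᵇy) tt)))

count : ∀ {p} {P : Pred ℕ p} → Decidable P → List ℕ → ℕ
count P? xs = length (filter P? xs)

count-++ : ∀ {p} {P : Pred ℕ p} (P? : Decidable P) xs ys →
  count P? (xs ++ ys) ≡ count P? xs + count P? ys
count-++ P? xs ys = trans (cong length (filter-++ P? xs ys)) (length-++ (filter P? xs))

countBelow : ℕ → List ℕ → ℕ
countBelow d = count (_<? d)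

countBelow-∷-< : ∀ {x d} xs → x < d → countBelow d (x ∷ xs) ≡ suc (countBelow d xs)
countBelow-∷-< {d = d} xs x<d = cong length (filter-accept (_<? d) x<d)

countBelow-all : ∀ {d xs} → All (_< d) xs → countBelow d xs ≡ length xs
countBelow-all {d} ps = cong length (filter-all (_<? d) ps)

countBelow-none : ∀ {d xs} → All (d ≤_) xs → countBelow d xs ≡ 0
countBelow-none {d} ps = cong length (filter-none (_<? d) (All.map ≤⇒≯ ps))

filter-cong-on : ∀ {p q} {P : Pred ℕ p} {Q : Pred ℕ q} (P? : Decidable P) (Q? : Decidable Q) {xs} →
  All (λ x → (P x → Q x) × (Q x → P x)) xs → filter P? xs ≡ filter Q? xs
filter-cong-on P? Q? [] = refl
filter-cong-on {P = P} P? Q? {x ∷ xs} ((to , from) ∷ P⇔Q) = by-cases (P? x)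
  where
  ih : filter P? xs ≡ filter Q? xs
  ih = filter-cong-on P? Q? P⇔Q

  by-cases : Dec (P x) → filter P? (x ∷ xs) ≡ filter Q? (x ∷ xs)
  by-cases (yes px) = trans (filter-accept P? px) (trans (cong (x ∷_) ih) (sym (filter-accept Q? (to px))))
  by-cases (no ¬px) = trans (filter-reject P? ¬px) (trans ih (sym (filter-reject Q? (λ qx → ¬px (from qx)))))

∈ᵇ-∈ : ∀ {x L} → Any (x ≡_) L → x ∈ᵇ L ≡ true
∈ᵇ-∈ {x} {L} x∈L = trans (isYes≗does (any? (x ≟_) L)) (dec-true (any? (x ≟_) L) x∈L)

∈ᵇ-∉ : ∀ {x L} → ¬ Any (x ≡_) L → x ∈ᵇ L ≡ false
∈ᵇ-∉ {x} {L} x∉L = trans (isYes≗does (any? (x ≟_) L)) (dec-false (any? (x ≟_) L) x∉L)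

minus-∷ˡ-∉ : ∀ {x} xs {L} → ¬ Any (x ≡_) L → minus (x ∷ xs) L ≡ x ∷ minus xs L
minus-∷ˡ-∉ _ {L} x∉L = filter-accept (λ z → ¬? (any? (z ≟_) L)) x∉L

minus-∷ˡ-∈ : ∀ {x} xs {L} → Any (x ≡_) L → minus (x ∷ xs) L ≡ minus xs L
minus-∷ˡ-∈ _ {L} x∈L = filter-reject (λ z → ¬? (any? (z ≟_) L)) (λ x∉L → x∉L x∈L)

minus-∷ʳ-∉ : ∀ {x xs} L → All (_≢ x) L → minus L (x ∷ xs) ≡ minus L xs
minus-∷ʳ-∉ [] _ = refl
minus-∷ʳ-∉ {x} {xs} (z ∷ L) (z≢x ∷ L≢x) = by-cases (any? (z ≟_) xs)
  where
  ih : minus L (x ∷ xs) ≡ minus L xs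
  ih = minus-∷ʳ-∉ L L≢x

  by-cases : Dec (Any (z ≡_) xs) → minus (z ∷ L) (x ∷ xs) ≡ minus (z ∷ L) xs
  by-cases (yes z∈xs) =
    trans (minus-∷ˡ-∈ L (there z∈xs)) (trans ih (sym (minus-∷ˡ-∈ L z∈xs)))
  by-cases (no z∉xs) =
    trans (minus-∷ˡ-∉ L z∉x∷xs) (trans (cong (z ∷_) ih) (sym (minus-∷ˡ-∉ L z∉xs)))
    where
    z∉x∷xs : ¬ Any (z ≡_) (x ∷ xs)
    z∉x∷xs (here z≡x) = z≢x z≡x
    z∉x∷xs (there z∈xs) = z∉xs z∈xs

minus-[] : ∀ L → minus L [] ≡ L
minus-[] L = filter-all (λ z → ¬? (any? (z ≟_) [])) (All.universal (λ _ ()) L)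

minus-∷ˡ-< : ∀ {x} xs {L} → All (x <_) L → minus (x ∷ xs) L ≡ x ∷ minus xs L
minus-∷ˡ-< xs x<L = minus-∷ˡ-∉ xs (All¬⇒¬Any (All.map <⇒≢ x<L))

minus-∷ʳ-< : ∀ {x xs} L → All (x <_) L → minus L (x ∷ xs) ≡ minus L xs
minus-∷ʳ-< L x<L = minus-∷ʳ-∉ L (All.map (λ x<z → ≢-sym (<⇒≢ x<z)) x<L)

minus-∷-∷ : ∀ {x xs ys} → All (x <_) xs → minus (x ∷ xs) (x ∷ ys) ≡ minus xs ys
minus-∷-∷ {xs = xs} x<xs = trans (minus-∷ˡ-∈ xs (here refl)) (minus-∷ʳ-< xs x<xs)

module _ {p} {P : Pred ℕ p} (P? : Decidable P) where

  private
    # = count P?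

    #-∷ : ∀ x xs → # (x ∷ xs) ≡ # [ x ] + # xs
    #-∷ x = count-++ P? [ x ]

  CountBalanced : List ℕ → List ℕ → Set
  CountBalanced S S' = # (minus S S') + # S' ≡ # (minus S' S) + # S

  count-minus-<-step : ∀ {x} xs S' → All (x <_) S' → CountBalanced xs S' → CountBalanced (x ∷ xs) S'
  count-minus-<-step {x} xs S' x<S' ih = begin
    # (minus (x ∷ xs) S') + # S'          ≡⟨ cong (λ A → # A + # S') (minus-∷ˡ-< xs x<S') ⟩
    # (x ∷ minus xs S') + # S'            ≡⟨ cong (_+ # S') (#-∷ x (minus xs S')) ⟩
    # [ x ] + # (minus xs S') + # S'      ≡⟨ +-assoc (# [ x ]) _ _ ⟩
    # [ x ] + (# (minus xs S') + # S')    ≡⟨ cong (# [ x ] +_) ih ⟩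
    # [ x ] + (# (minus S' xs) + # xs)    ≡⟨ x∙yz≈y∙xz (# [ x ]) (# (minus S' xs)) (# xs) ⟩
    # (minus S' xs) + (# [ x ] + # xs)    ≡⟨ cong₂ _+_ (cong # (minus-∷ʳ-< S' x<S')) (#-∷ x xs) ⟨
    # (minus S' (x ∷ xs)) + # (x ∷ xs)    ∎
    where open ≡-Reasoning

  count-minus-cmp-step : ∀ {x xs y ys} → All (x <_) xs → All (y <_) ys → Tri (x < y) (x ≡ y) (y < x) →
    CountBalanced xs (y ∷ ys) → CountBalanced xs ys → CountBalanced (x ∷ xs) ys →
    CountBalanced (x ∷ xs) (y ∷ ys)
  count-minus-cmp-step {x} {xs} {y} {ys} _ y<ys (tri< x<y _ _) ih _ _ =
    count-minus-<-step xs (y ∷ ys) (x<y ∷ All.map (<-trans x<y) y<ys) ih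
  count-minus-cmp-step {x} {xs} {y} {ys} x<xs _ (tri> _ _ y<x) _ _ ih =
    sym (count-minus-<-step ys (x ∷ xs) (y<x ∷ All.map (<-trans y<x) x<xs) (sym ih))
  count-minus-cmp-step {x} {xs} {.x} {ys} x<xs x<ys (tri≈ _ refl _) _ ih _ = begin
    # (minus (x ∷ xs) (x ∷ ys)) + # (x ∷ ys)     ≡⟨ cong₂ _+_ (cong # (minus-∷-∷ x<xs)) (#-∷ x ys) ⟩
    # (minus xs ys) + (# [ x ] + # ys)           ≡⟨ x∙yz≈y∙xz (# (minus xs ys)) (# [ x ]) (# ys) ⟩
    # [ x ] + (# (minus xs ys) + # ys)           ≡⟨ cong (# [ x ] +_) ih ⟩
    # [ x ] + (# (minus ys xs) + # xs)           ≡⟨ x∙yz≈y∙xz (# [ x ]) (# (minus ys xs)) (# xs) ⟩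
    # (minus ys xs) + (# [ x ] + # xs)           ≡⟨ cong₂ _+_ (cong # (minus-∷-∷ x<ys)) (#-∷ x xs) ⟨
    # (minus (x ∷ ys) (x ∷ xs)) + # (x ∷ xs)     ∎
    where open ≡-Reasoning

  count-minus-balance : ∀ S S' → AllPairs _<_ S → AllPairs _<_ S' → CountBalanced S S'
  count-minus-balance [] S' _ _ = sym (trans (+-identityʳ _) (cong # (minus-[] S')))
  count-minus-balance (x ∷ xs) [] _ _ = trans (+-identityʳ _) (cong # (minus-[] (x ∷ xs)))
  count-minus-balance (x ∷ xs) (y ∷ ys) (x<xs ∷ sxs) (y<ys ∷ sys) =
    count-minus-cmp-step x<xs y<ys (<-cmp x y)
      (count-minus-balance xs (y ∷ ys) sxs (y<ys ∷ sys))
      (count-minus-balance xs ys sxs sys)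
      (count-minus-balance (x ∷ xs) ys (x<xs ∷ sxs) sys)

countBelow-minus-balance : ∀ d {S S'} → AllPairs _<_ S → AllPairs _<_ S' →
  countBelow d (minus S S') + countBelow d S' ≡ countBelow d (minus S' S) + countBelow d S
countBelow-minus-balance d = count-minus-balance (_<? d) _ _

length-minus-balance : ∀ {S S'} → AllPairs _<_ S → AllPairs _<_ S' →
  length (minus S S') + length S' ≡ length (minus S' S) + length S
length-minus-balance {S} {S'} sS sS' = begin
  length (minus S S') + length S'        ≡⟨ cong₂ _+_ (count-U (minus S S')) (count-U S') ⟨
  count U? (minus S S') + count U? S'    ≡⟨ count-minus-balance U? S S' sS sS' ⟩
  count U? (minus S' S) + count U? S     ≡⟨ cong₂ _+_ (count-U (minus S' S)) (count-U S) ⟩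
  length (minus S' S) + length S         ∎
  where
  open ≡-Reasoning
  count-U : ∀ xs → count U? xs ≡ length xs
  count-U xs = cong length (filter-all U? (All.universal (λ _ → tt) xs))

∸-balance : ∀ {a b c c'} → a + c' ≡ b + c → a ∸ b ≡ c ∸ c'
∸-balance {a} {b} {c} {c'} eq = begin
  a ∸ b                ≡⟨ [m+n]∸[m+o]≡n∸o c' a b ⟨
  (c' + a) ∸ (c' + b)  ≡⟨ cong₂ _∸_ (trans (+-comm c' a) eq) (+-comm c' b) ⟩
  (b + c) ∸ (b + c')   ≡⟨ [m+n]∸[m+o]≡n∸o b c c' ⟩
  c ∸ c'               ∎
  where open ≡-Reasoning

<-balance : ∀ {a b c c'} → a + c' ≡ b + c → c' < c → b < a
<-balance {a} {b} {c} {c'} eq c'<c = +-cancelʳ-< c' b a (subst (b + c' <_) (sym eq) (+-monoʳ-< b c'<c))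

inLeg? : ∀ c d → Decidable (λ x → c ≤ x × x ≤ d)
inLeg? c d x = (c ≤? x) ×-dec (x ≤? d)

filter-inLeg : ∀ {c d} S → All (c ≤_) S → ¬ Any (d ≡_) S → filter (inLeg? c d) S ≡ filter (_<? d) S
filter-inLeg {c} {d} S c≤S d∉S = filter-cong-on (inLeg? c d) (_<? d) (All.zipWith leg⇔below (c≤S , ¬Any⇒All¬ S d∉S))
  where
  leg⇔below : ∀ {x} → c ≤ x × d ≢ x → (c ≤ x × x ≤ d → x < d) × (x < d → c ≤ x × x ≤ d)
  leg⇔below (c≤x , d≢x) = (λ (_ , x≤d) → ≤∧≢⇒< x≤d (≢-sym d≢x)) , (λ x<d → c≤x , <⇒≤ x<d)

row-leg-gap : ∀ {c d} P P' cs ds → length P ≡ length P' → All (_< c) P → All (_< d) P' →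
  All (c <_) cs → All (d <_) ds → c ≤ d → ¬ Any (d ≡_) (P ++ c ∷ cs) →
  length (filter (inLeg? c d) (P ++ c ∷ cs)) ≡ countBelow d (P ++ c ∷ cs) ∸ countBelow d (P' ++ d ∷ ds)
  × countBelow d (P' ++ d ∷ ds) < countBelow d (P ++ c ∷ cs)
row-leg-gap {c} {d} P P' cs ds |P|≡|P'| P<c P'<d c<cs d<ds c≤d d∉C =
  trans leg≡m (sym gap≡m) ,
  subst₂ _<_ (sym below-C') (sym below-C) (m<m+n (length P') (subst (0 <_) (sym m≡suc) z<s))
  where
  d∉c∷cs : ¬ Any (d ≡_) (c ∷ cs)
  d∉c∷cs d∈c∷cs = d∉C (++⁺ʳ P d∈c∷cs)
  c<d : c < d
  c<d = ≤∧≢⇒< c≤d (λ c≡d → d∉c∷cs (here (sym c≡d)))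
  m = countBelow d (c ∷ cs)
  m≡suc : m ≡ suc (countBelow d cs)
  m≡suc = countBelow-∷-< cs c<d
  below-C' : countBelow d (P' ++ d ∷ ds) ≡ length P'
  below-C' = trans (count-++ (_<? d) P' (d ∷ ds))
    (trans (cong₂ _+_ (countBelow-all P'<d) (countBelow-none (≤-refl ∷ All.map <⇒≤ d<ds))) (+-identityʳ _))
  below-C : countBelow d (P ++ c ∷ cs) ≡ length P' + m
  below-C = trans (count-++ (_<? d) P (c ∷ cs))
    (cong (_+ m) (trans (countBelow-all (All.map (λ p<c → <-≤-trans p<c c≤d) P<c)) |P|≡|P'|))
  gap≡m : countBelow d (P ++ c ∷ cs) ∸ countBelow d (P' ++ d ∷ ds) ≡ m
  gap≡m = trans (cong₂ _∸_ below-C below-C') (m+n∸m≡n (length P') m)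
  leg≡m : length (filter (inLeg? c d) (P ++ c ∷ cs)) ≡ m
  leg≡m = begin
    length (filter (inLeg? c d) (P ++ c ∷ cs))   ≡⟨ count-++ (inLeg? c d) P (c ∷ cs) ⟩
    length (filter (inLeg? c d) P) + length (filter (inLeg? c d) (c ∷ cs))
      ≡⟨ cong₂ (λ A B → length A + length B)
           (filter-none (inLeg? c d) (All.map (λ p<c (c≤p , _) → <⇒≱ p<c c≤p) P<c))
           (filter-inLeg (c ∷ cs) (≤-refl ∷ All.map <⇒≤ c<cs) d∉c∷cs) ⟩
    m ∎
    where open ≡-Reasoning

-- In mergeLab A B, started at height h, the down-step of d ∈ B leaves from height
-- h + #{a ∈ A : a < d} − #{b ∈ B : b < d}; Ahead says that all these heights are positive.
Ahead : ℕ → List ℕ → List ℕ → Set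
Ahead h A B = All (λ d → countBelow d B < h + countBelow d A) B

module _ {c ℓ} (R : CommutativeRing c ℓ) (Y : CommutativeRing.Carrier R) where
  open CommutativeRing R
    using (Carrier; 1#; _*_; _≈_; setoid; *-assoc; *-comm; *-identityˡ; *-identityʳ; *-cong; *-congˡ; *-congʳ;
           *-commutativeSemigroup)
    renaming (refl to ≈-refl; sym to ≈-sym; trans to ≈-trans; reflexive to ≈-reflexive)
  open import Relation.Binary.Reasoning.Setoid setoid
  open import Algebra.Properties.CommutativeSemigroup *-commutativeSemigroup using (interchange)

  ⟦_⟧ : ℕ → Carrier
  ⟦_⟧ = qint R Y

  ∏ : ∀ {a} {A : Set a} → (A → Carrier) → List A → Carrier
  ∏ f = foldr (λ x acc → f x * acc) 1#

  ∏-++ : ∀ {a} {A : Set a} (f : A → Carrier) xs ys → ∏ f (xs ++ ys) ≈ ∏ f xs * ∏ f ys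
  ∏-++ f [] ys = ≈-sym (*-identityˡ _)
  ∏-++ f (x ∷ xs) ys = ≈-trans (*-congˡ (∏-++ f xs ys)) (≈-sym (*-assoc _ _ _))

  ∏-cong : ∀ {a} {A : Set a} {f g : A → Carrier} {xs} → All (λ x → f x ≈ g x) xs → ∏ f xs ≈ ∏ g xs
  ∏-cong [] = ≈-refl
  ∏-cong (fx≈gx ∷ fxs≈gxs) = *-cong fx≈gx (∏-cong fxs≈gxs)

  weight : ℕ → List Letter → Carrier
  weight h [] = 1#
  weight h (𝟎 ∷ w) = weight (suc h) w
  weight h (𝟏 ∷ w) = ⟦ h ⟧ * weight (pred h) w

  weight-++ : ∀ h u v → weight h (u ++ v) ≈ weight h u * weight (height h u) v
  weight-++ h [] v = ≈-sym (*-identityˡ _)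
  weight-++ h (𝟎 ∷ u) v = weight-++ (suc h) u v
  weight-++ h (𝟏 ∷ u) v = ≈-trans (*-congˡ (weight-++ (pred h) u v)) (≈-sym (*-assoc _ _ _))

  weight-𝟏^ : ∀ k → weight k (replicate k 𝟏) ≈ qfact R Y k
  weight-𝟏^ zero = ≈-refl
  weight-𝟏^ (suc k) = ≈-trans (*-congˡ (weight-𝟏^ k)) (*-comm _ _)

  weight-𝟎^-++ : ∀ l h w → weight h (replicate l 𝟎 ++ w) ≡ weight (h + l) w
  weight-𝟎^-++ zero h w = cong (λ z → weight z w) (sym (+-identityʳ h))
  weight-𝟎^-++ (suc l) h w = trans (weight-𝟎^-++ l (suc h) w) (cong (λ z → weight z w) (sym (+-suc h l)))

  weight-𝟏^-++ : ∀ m b w → weight (b + m) (replicate m 𝟏 ++ w) ≈ qratioD R Y b m * weight b w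
  weight-𝟏^-++ zero b w = ≈-trans (≈-reflexive (cong (λ z → weight z w) (+-identityʳ b))) (≈-sym (*-identityˡ _))
  weight-𝟏^-++ (suc m) b w = begin
    ⟦ b + suc m ⟧ * weight (pred (b + suc m)) (replicate m 𝟏 ++ w)
      ≡⟨ cong (λ z → ⟦ b + suc m ⟧ * weight (pred z) (replicate m 𝟏 ++ w)) (+-suc b m) ⟩
    ⟦ b + suc m ⟧ * weight (b + m) (replicate m 𝟏 ++ w)
      ≈⟨ *-congˡ (weight-𝟏^-++ m b w) ⟩
    ⟦ b + suc m ⟧ * (qratioD R Y b m * weight b w)
      ≈⟨ *-assoc _ _ _ ⟨
    ⟦ b + suc m ⟧ * qratioD R Y b m * weight b w
      ≈⟨ *-congʳ (*-comm _ _) ⟩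
    qratioD R Y b m * ⟦ b + suc m ⟧ * weight b w
      ∎

  Pruns≈weight : ∀ b rs → Ballot b (unruns rs) → Pruns R Y b rs ≈ weight b (unruns rs)
  Pruns≈weight b [] _ = ≈-refl
  Pruns≈weight b ((l , m) ∷ rs) ballot = begin
    qratioD R Y b' (m + b' ∸ b') * Pruns R Y b' rs
      ≈⟨ *-cong (≈-reflexive (cong (qratioD R Y b') (m+n∸n≡m m b'))) (Pruns≈weight b' rs ballot-rs) ⟩
    qratioD R Y b' m * weight b' (unruns rs)
      ≈⟨ weight-𝟏^-++ m b' (unruns rs) ⟨
    weight (b' + m) (replicate m 𝟏 ++ unruns rs)
      ≡⟨ cong (λ z → weight z (replicate m 𝟏 ++ unruns rs)) b+l≡b'+m ⟨
    weight (b + l) (replicate m 𝟏 ++ unruns rs)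
      ≡⟨ weight-𝟎^-++ l b _ ⟨
    weight b (unruns ((l , m) ∷ rs))
      ∎
    where
    b' = b + l ∸ m
    ballot-𝟏s : Ballot (b + l) (replicate m 𝟏 ++ unruns rs)
    ballot-𝟏s = ballot-𝟎^ l b _ ballot
    b+l≡b'+m : b + l ≡ b' + m
    b+l≡b'+m = sym (m∸n+n≡m (ballot-𝟏^⇒≤ m (b + l) _ ballot-𝟏s))
    ballot-rs : Ballot b' (unruns rs)
    ballot-rs = ballot-𝟏^-++ m b' _ (subst (λ z → Ballot z (replicate m 𝟏 ++ unruns rs)) b+l≡b'+m ballot-𝟏s)

  P≈weight : ∀ w → Ballot 0 w → P R Y w ≈ weight 0 w
  P≈weight w ballot = begin
    Pruns R Y 0 (runs w)         ≈⟨ Pruns≈weight 0 (runs w) (subst (Ballot 0) (sym (unruns-runs w)) ballot) ⟩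
    weight 0 (unruns (runs w))   ≡⟨ cong (weight 0) (unruns-runs w) ⟩
    weight 0 w                   ∎

  BallotWeight : ℕ → List Letter → Carrier → Set ℓ
  BallotWeight h w x = Ballot h w × weight h w ≈ x

  BallotWeight-≡ : ∀ {h w w' x} → w ≡ w' → BallotWeight h w' x → BallotWeight h w x
  BallotWeight-≡ refl bw = bw

  MergeWeight : ℕ → List ℕ → List ℕ → Set ℓ
  MergeWeight h A B = BallotWeight h (mergeLab A B) (∏ (λ d → ⟦ h + countBelow d A ∸ countBelow d B ⟧) B)

  mergeLab-weight-𝟎 : ∀ h {x} A B → All (x <_) B →
    (Ahead (suc h) A B → MergeWeight (suc h) A B) → Ahead h (x ∷ A) B → MergeWeight h (x ∷ A) B
  mergeLab-weight-𝟎 h {x} A B x<B ih ahead =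
    BallotWeight-≡ (mergeLab-𝟎 A x<B) $
    proj₁ r , ≈-trans (proj₂ r) (∏-cong (All.map (λ {d} x<d →
      ≈-reflexive (cong (λ n → ⟦ n ∸ countBelow d B ⟧) (sym (shift x<d)))) x<B))
    where
    shift : ∀ {d} → x < d → h + countBelow d (x ∷ A) ≡ suc h + countBelow d A
    shift {d} x<d = trans (cong (h +_) (countBelow-∷-< A x<d)) (+-suc h _)
    r = ih (All.zipWith (λ {d} (x<d , lt) → subst (countBelow d B <_) (shift x<d) lt) (x<B , ahead))

  mergeLab-weight-𝟏 : ∀ h {y} A B → All (y ≤_) A → All (y <_) B →
    (Ahead (pred h) A B → MergeWeight (pred h) A B) → Ahead h A (y ∷ B) → MergeWeight h A (y ∷ B)
  mergeLab-weight-𝟏 zero {y} A B y≤A y<B _ (ahead-y ∷ _) =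
    ⊥-elim (<-irrefl refl
      (subst₂ _<_ (countBelow-none (≤-refl ∷ All.map <⇒≤ y<B)) (countBelow-none y≤A) ahead-y))
  mergeLab-weight-𝟏 (suc h) {y} A B y≤A y<B ih (ahead-y ∷ ahead) =
    BallotWeight-≡ (mergeLab-𝟏 A y≤A) $
    proj₁ r ,
    *-cong (≈-reflexive (cong ⟦_⟧ (sym top)))
           (≈-trans (proj₂ r) (∏-cong (All.map (λ {d} y<d →
              ≈-reflexive (cong (λ n → ⟦ suc h + countBelow d A ∸ n ⟧) (sym (countBelow-∷-< B y<d)))) y<B)))
    where
    r = ih (All.zipWith (λ {d} (y<d , lt) → s≤s⁻¹ (subst (_< suc h + countBelow d A) (countBelow-∷-< B y<d) lt))
                        (y<B , ahead))
    top : suc h + countBelow y A ∸ countBelow y (y ∷ B) ≡ suc h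
    top rewrite countBelow-none y≤A | countBelow-none (≤-refl ∷ All.map <⇒≤ y<B) = +-identityʳ (suc h)

  mergeLab-weight-cmp : ∀ h {x y} A B → All (x <_) A → All (y <_) B → Dec (x < y) →
    (Ahead (suc h) A (y ∷ B) → MergeWeight (suc h) A (y ∷ B)) →
    (Ahead (pred h) (x ∷ A) B → MergeWeight (pred h) (x ∷ A) B) →
    Ahead h (x ∷ A) (y ∷ B) → MergeWeight h (x ∷ A) (y ∷ B)
  mergeLab-weight-cmp h A B _ y<B (yes x<y) ih _ =
    mergeLab-weight-𝟎 h A (_ ∷ B) (x<y ∷ All.map (<-trans x<y) y<B) ih
  mergeLab-weight-cmp h A B x<A y<B (no x≮y) _ ih =
    mergeLab-weight-𝟏 h (_ ∷ A) B (y≤x ∷ All.map (λ x<a → ≤-trans y≤x (<⇒≤ x<a)) x<A) y<B ih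
    where y≤x = ≮⇒≥ x≮y

  mergeLab-weight : ∀ h A B → AllPairs _<_ A → AllPairs _<_ B → Ahead h A B → MergeWeight h A B
  mergeLab-weight h [] [] _ _ _ = tt , ≈-refl
  mergeLab-weight h [] (y ∷ B) _ (y<B ∷ sB) =
    mergeLab-weight-𝟏 h [] B [] y<B (mergeLab-weight (pred h) [] B [] sB)
  mergeLab-weight h (x ∷ A) [] (x<A ∷ sA) _ =
    mergeLab-weight-𝟎 h A [] [] (mergeLab-weight (suc h) A [] sA [])
  mergeLab-weight h (x ∷ A) (y ∷ B) (x<A ∷ sA) (y<B ∷ sB) =
    mergeLab-weight-cmp h A B x<A y<B (x <? y)
      (mergeLab-weight (suc h) A (y ∷ B) sA (y<B ∷ sB))
      (mergeLab-weight (pred h) (x ∷ A) B (x<A ∷ sA) sB)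

  legFactor≡⟦length⟧ : ∀ L → legFactor R Y L ≡ ⟦ length L ⟧
  legFactor≡⟦length⟧ [] = refl
  legFactor≡⟦length⟧ (_ ∷ _) = refl

  ∏-legsCol-[] : ∀ C S → ∏ (legFactor R Y) (legsCol R C S []) ≈ 1#
  ∏-legsCol-[] C [] = ≈-refl
  ∏-legsCol-[] C (_ ∷ S) = ≈-trans (*-identityˡ _) (∏-legsCol-[] C S)

  Gap : List ℕ → List ℕ → ℕ → Carrier
  Gap C C' d = ⟦ countBelow d C ∸ countBelow d C' ⟧

  LegsProduct : List ℕ → List ℕ → List (List ℕ) → List ℕ → Set ℓ
  LegsProduct C C' legs B =
    ∏ (legFactor R Y) legs ≈ ∏ (Gap C C') B × All (λ d → countBelow d C' < countBelow d C) B

  ∏-legsCol : ∀ P P' S S' → length P ≡ length P' →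
    All (λ p → All (p <_) S) P → All (λ p → All (p <_) S') P' →
    AllPairs _<_ S → AllPairs _<_ S' → RowWeak S S' →
    LegsProduct (P ++ S) (P' ++ S') (legsCol R (P ++ S) S S') (minus S' (P ++ S))
  ∏-legsCol P P' S [] _ _ _ _ _ _ = ∏-legsCol-[] (P ++ S) S , []
  ∏-legsCol P P' (c ∷ cs) (d ∷ ds) |P|≡|P'| P<S P'<S' (c<cs ∷ scs) (d<ds ∷ sds) (c≤d , rw) =
    by-cases (any? (d ≟_) C)
    where
    C = P ++ c ∷ cs
    C' = P' ++ d ∷ ds
    ih : LegsProduct C C' (legsCol R C cs ds) (minus ds C)
    ih = subst₂ (λ C C' → LegsProduct C C' (legsCol R C cs ds) (minus ds C))
      (++-assoc P [ c ] cs) (++-assoc P' [ d ] ds)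
      (∏-legsCol (P ++ [ c ]) (P' ++ [ d ]) cs ds
        (trans (length-++ P) (trans (cong (_+ 1) |P|≡|P'|) (sym (length-++ P'))))
        (++⁺ (All.map All.tail P<S) (c<cs ∷ [])) (++⁺ (All.map All.tail P'<S') (d<ds ∷ [])) scs sds rw)

    legs = legsCol R C (c ∷ cs) (d ∷ ds)

    factor : Bool → Carrier
    factor b = legFactor R Y (if b then [] else filter (inLeg? c d) C)

    by-cases : Dec (Any (d ≡_) C) → LegsProduct C C' legs (minus (d ∷ ds) C)
    by-cases (yes d∈C) = subst (LegsProduct C C' legs) (sym (minus-∷ˡ-∈ ds d∈C)) $
      ≈-trans (*-congʳ (≈-reflexive (cong factor (∈ᵇ-∈ d∈C)))) (≈-trans (*-identityˡ _) (proj₁ ih)) ,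
      proj₂ ih
    by-cases (no d∉C) = subst (LegsProduct C C' legs) (sym (minus-∷ˡ-∉ ds d∉C)) $
      *-cong (≈-reflexive factor≡gap) (proj₁ ih) , proj₂ row ∷ proj₂ ih
      where
      row = row-leg-gap P P' cs ds |P|≡|P'| (All.map All.head P<S) (All.map All.head P'<S') c<cs d<ds c≤d d∉C
      factor≡gap : factor (d ∈ᵇ C) ≡ Gap C C' d
      factor≡gap = trans (cong factor (∈ᵇ-∉ d∉C))
                         (trans (legFactor≡⟦length⟧ (filter (inLeg? c d) C)) (cong ⟦_⟧ (proj₁ row)))

  D₂-weight : ∀ {C C'} → AllPairs _<_ C → AllPairs _<_ C' → RowWeak C C' →
    Dyck (D₂ C C') ×
    weight 0 (D₂ C C') ≈ ∏ (legFactor R Y) (legsCol R C C C') * qfact R Y (length C ∸ length C')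
  D₂-weight {C} {C'} sC sC' rw = dyck-𝟏^ W k (proj₁ merge) height≡k , (begin
    weight 0 (W ++ replicate k 𝟏)
      ≈⟨ weight-++ 0 W (replicate k 𝟏) ⟩
    weight 0 W * weight (height 0 W) (replicate k 𝟏)
      ≡⟨ cong (λ h → weight 0 W * weight h (replicate k 𝟏)) height≡k ⟩
    weight 0 W * weight k (replicate k 𝟏)
      ≈⟨ *-cong (proj₂ merge) (weight-𝟏^ k) ⟩
    ∏ (λ d → ⟦ countBelow d A ∸ countBelow d B ⟧) B * qfact R Y k
      ≈⟨ *-cong (∏-cong gaps) (≈-reflexive (cong (qfact R Y) k≡)) ⟩
    ∏ (Gap C C') B * qfact R Y (length C ∸ length C')
      ≈⟨ *-congʳ (proj₁ legs) ⟨
    ∏ (legFactor R Y) (legsCol R C C C') * qfact R Y (length C ∸ length C')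
      ∎)
    where
    A = minus C C'
    B = minus C' C
    W = mergeLab A B
    k = length A ∸ length B
    legs : LegsProduct C C' (legsCol R C C C') B
    legs = ∏-legsCol [] [] C C' refl [] [] sC sC' rw
    balance : ∀ d → countBelow d A + countBelow d C' ≡ countBelow d B + countBelow d C
    balance d = countBelow-minus-balance d sC sC'
    gaps : All (λ d → ⟦ countBelow d A ∸ countBelow d B ⟧ ≈ Gap C C' d) B
    gaps = All.universal (λ d → ≈-reflexive (cong ⟦_⟧
      (∸-balance {countBelow d A} {countBelow d B} {countBelow d C} {countBelow d C'} (balance d)))) B
    merge : MergeWeight 0 A B
    merge = mergeLab-weight 0 A B (AllPairsₚ.filter⁺ _ sC) (AllPairsₚ.filter⁺ _ sC')
      (All.map (λ {d} → <-balance {countBelow d A} {countBelow d B} {countBelow d C} {countBelow d C'} (balance d))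
               (proj₂ legs))
    height≡k : height 0 W ≡ k
    height≡k = trans (sym (m+n∸n≡m (height 0 W) (length B)))
      (cong (_∸ length B) (subst₂ (λ n₁ n₀ → height 0 W + n₁ ≡ n₀) (#𝟏-mergeLab A B) (#𝟎-mergeLab A B)
                                  (ballot-height 0 W (proj₁ merge))))
    k≡ : k ≡ length C ∸ length C'
    k≡ = ∸-balance {length A} {length B} {length C} {length C'} (length-minus-balance sC sC')

  Dcols-weight : ∀ Cs → All (AllPairs _<_) Cs → Linked RowWeak Cs →
    Dyck (Dcols Cs) × weight 0 (Dcols Cs) ≈ ∏ (legFactor R Y) (legsCols R Cs) * phaCols R Y Cs
  Dcols-weight [] _ _ = (tt , refl) , ≈-sym (*-identityˡ 1#)
  Dcols-weight (C ∷ []) _ _ = (tt , refl) , ≈-sym (≈-trans (*-identityʳ _) (∏-legsCol-[] C C))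
  Dcols-weight (C ∷ C' ∷ Cs) (sC ∷ sCs) (rw ∷ rws) = dyck-++ u v (proj₁ pair) (proj₁ rest) , (begin
    weight 0 (u ++ v)
      ≈⟨ weight-++ 0 u v ⟩
    weight 0 u * weight (height 0 u) v
      ≡⟨ cong (λ h → weight 0 u * weight h v) (proj₂ (proj₁ pair)) ⟩
    weight 0 u * weight 0 v
      ≈⟨ *-cong (proj₂ pair) (proj₂ rest) ⟩
    (∏ (legFactor R Y) legs₁ * qfact R Y (length C ∸ length C')) * (∏ (legFactor R Y) legs₂ * phaCols R Y (C' ∷ Cs))
      ≈⟨ interchange _ _ _ _ ⟩
    (∏ (legFactor R Y) legs₁ * ∏ (legFactor R Y) legs₂) * (qfact R Y (length C ∸ length C') * phaCols R Y (C' ∷ Cs))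
      ≈⟨ *-congʳ (∏-++ (legFactor R Y) legs₁ legs₂) ⟨
    ∏ (legFactor R Y) (legs₁ ++ legs₂) * phaCols R Y (C ∷ C' ∷ Cs)
      ∎)
    where
    u = D₂ C C'
    v = Dcols (C' ∷ Cs)
    legs₁ = legsCol R C C C'
    legs₂ = legsCols R (C' ∷ Cs)
    pair = D₂-weight sC (All.head sCs) rw
    rest = Dcols-weight (C' ∷ Cs) sCs rws

proposition5p2 : ∀ {c ℓ} (R : CommutativeRing c ℓ) (Y : CommutativeRing.Carrier R)
    (n : ℕ) (T : SSYT n) →
    CommutativeRing._≈_ R (P R Y (D T)) (CommutativeRing._*_ R (Φ R Y T) (pha R Y T))
proposition5p2 R Y n T = CommutativeRing.trans R (P≈weight R Y (D T) (proj₁ (proj₁ word))) (proj₂ word)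
  where
  word = Dcols-weight R Y (cols T) (All.map (Linked⇒AllPairs <-trans) (colStrict T)) (rowWeak T)
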